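{- For all integers $m,n\ge 1$, \[R(\mathbf{V}_{m,m},\mathbf{V}_{n,n})=m+n+1.\]
   Context: The Boolean lattice $\mathbf{B}_N$ is the poset $(2^{[N]},\subseteq)$ of all subsets of $[N]=\{1,\dots,N\}$ ordered by inclusion. A poset $\mathbf{Q}$ contains a poset $\mathbf{P}$ as a subposet if there is an injection $\phi$ from the elements of $\mathbf{P}$ to those of $\mathbf{Q}$ with $x\le_{\mathbf{P}} y$ if and only if $\phi(x)\le_{\mathbf{Q}}\phi(y)$. For integers $n\ge m\ge 1$, $\mathbf{V}_{m,n}$ is the poset on $m+n+1$ elements $x,y_1,\dots,y_m,z_1,\dots,z_n$ whose order relations are generated by $x<y_1<\cdots<y_m$ and $x<z_1<\cdots<z_n$. For posets $\mathbf{P}_1,\mathbf{P}_2$, $R(\mathbf{P}_1,\mathbf{P}_2)$ is the minimum $N$ such that for every coloring $c:2^{[N]}\to\{1,2\}$, $\mathbf{B}_N$ contains a subposet isomorphic to $\mathbf{P}_1$ all of whose elements have color $1$ or a subposet isomorphic to $\mathbf{P}_2$ all of whose elements have color $2$. -}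

module Defs where

open import Data.Nat using (ℕ; _<_)
open import Data.Fin using (Fin; zero; suc; _≤_)
open import Data.Fin.Subset using (Subset; _⊆_)
open import Data.Product using (Σ; _×_)
open import Data.Sum using (_⊎_)
open import Data.Empty using (⊥)
open import Data.Unit using (⊤)
open import Relation.Nullary using (¬_)
open import Relation.Binary.PropositionalEquality using (_≡_)
open import Function.Definitions using (Injective)
open import Function.Bundles using (_⇔_)

-- The poset V_{a,b}: elements x, y_1..y_a (indexed by Fin a), z_1..z_b (Fin b).
data VElem (a b : ℕ) : Set where
  vx : VElem a b
  vy : Fin a → VElem a b
  vz : Fin b → VElem a b

data VLe {a b : ℕ} : VElem a b → VElem a b → Set where
  x≤any : ∀ {p} → VLe vx p
  y≤y   : ∀ {i j} → i ≤ j → VLe (vy i) (vy j)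
  z≤z   : ∀ {i j} → i ≤ j → VLe (vz i) (vz j)

record Pos : Set₁ where
  field
    Elem : Set
    _≤P_ : Elem → Elem → Set

V : ℕ → ℕ → Pos
V a b = record { Elem = VElem a b ; _≤P_ = VLe }

-- A 2-colouring of the Boolean lattice B_N (colour 1 = zero, colour 2 = suc zero).
Colouring : ℕ → Set
Colouring N = Subset N → Fin 2

MonoCopy : Pos → (N : ℕ) → Colouring N → Fin 2 → Set
MonoCopy P N c col =
  Σ (Pos.Elem P → Subset N) λ φ →
    Injective _≡_ _≡_ φ
    × (∀ p q → (Pos._≤P_ P p q ⇔ (φ p ⊆ φ q)))
    × (∀ p → c (φ p) ≡ col)

RamseyProp : Pos → Pos → ℕ → Set
RamseyProp P₁ P₂ N = ∀ (c : Colouring N) → MonoCopy P₁ N c zero ⊎ MonoCopy P₂ N c (suc zero)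

RamseyNumberIs : Pos → Pos → ℕ → Set
RamseyNumberIs P₁ P₂ r = RamseyProp P₁ P₂ r × (∀ N → N < r → ¬ RamseyProp P₁ P₂ N)

{-# OPTIONS --safe #-}

-- Lower bound (N ≤ m + n): colour a set red iff it has at least n elements.  A red V_{m,m}
-- consists of two strict chains of m + 1 sets of size ≥ n, so both tops have size ≥ N and are
-- the whole ground set; a blue V_{n,n} contains a set of size ≥ n.
--
-- Upper bound, with N = m + n + 1 and, after swapping colours, ∅ red: say a → b when some red
-- strict chain of m sets contains a and avoids b; a → b → a gives a red V_{m,m} over ∅.  Rank the
-- points with a first and two points b, c last, and look at the sublevel sets L₀ ⊂ L₁ ⊂ ….
-- If L₀, …, L_{m-1} are red then a → b.  Otherwise let L_k be the first blue level and move b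
-- (resp. c) to rank k + 1: by pigeonhole the new levels above k give either enough red sets to
-- continue L₀, …, L_{k-1} to a red chain, so a → c (resp. a → b), or n blue sets above L_k
-- containing b but not c (resp. c but not b), and the two blue chains over L_k form a blue
-- V_{n,n}.  So every point reaches one of any two others; on four points this forces a
-- two-cycle, and on the three points available when m = n = 1 a three-cycle a → b → c → a
-- still yields two incomparable red sets.

module Submission where

open import Defs
open import Data.Bool.Properties using (T-≡)
open import Data.Empty using (⊥-elim)
open import Data.Fin as F using (Fin; zero; suc; toℕ; fromℕ; fromℕ<; inject₁; #_; splitAt; _↑ˡ_; _↑ʳ_)
open import Data.Fin.Properties as Fₚ
  using (splitAt-↑ˡ; splitAt-↑ʳ; toℕ-fromℕ<; toℕ-injective; ↑ˡ-injective; ≤̄⇒inject₁<; ¬∀⟶∃¬)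
open import Data.Fin.Subset using (Subset; _⊆_; _∈_; _∉_; ∣_∣; ⊤) renaming (⊥ to ∅)
open import Data.Fin.Subset.Properties using (∉⊥; ⊆-antisym; _∈?_; p⊂q⇒∣p∣<∣q∣; ∣p∣≤n; ∣p∣≡n⇒p≡⊤)
open import Data.Nat using (ℕ; zero; suc; _+_; _≤_; _<_; _≤ᵇ_; _≤?_; z≤n; s≤s; s≤s⁻¹; z<s)
open import Data.Nat.Properties
open import Data.Nat.Tactic.RingSolver using (solve-∀)
open import Data.Product using (∃; _×_; _,_; proj₁; proj₂)
open import Data.Sum using (_⊎_; inj₁; inj₂; [_,_]′) renaming (map to ⊎-map)
open import Data.Vec using (tabulate)
open import Data.Vec.Properties using (lookup∘tabulate; []=⇒lookup; lookup⇒[]=)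
open import Function using (_∘_)
open import Function.Bundles using (_⇔_; mk⇔; Equivalence)
open import Relation.Nullary using (¬_; yes; no)
open import Relation.Nullary.Decidable using (decidable-stable; _→-dec_)
open import Relation.Binary.PropositionalEquality

pattern red  = zero
pattern blue = suc zero

module _ {N : ℕ} where

  sublevel : (Fin N → ℕ) → ℕ → Subset N
  sublevel r t = tabulate (λ x → r x ≤ᵇ t)

  Attains : (Fin N → ℕ) → ℕ → Set
  Attains r B = ∀ t → 0 < t → t ≤ B → ∃ λ x → r x ≡ t

  module _ (r : Fin N → ℕ) where

    ∈sublevel⁺ : ∀ {t x} → r x ≤ t → x ∈ sublevel r t
    ∈sublevel⁺ {t} {x} rx≤t =
      lookup⇒[]= x (sublevel r t) (trans (lookup∘tabulate _ x) (Equivalence.to T-≡ (≤⇒≤ᵇ rx≤t)))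

    ∈sublevel⁻ : ∀ {t x} → x ∈ sublevel r t → r x ≤ t
    ∈sublevel⁻ {t} {x} x∈ =
      ≤ᵇ⇒≤ (r x) t (Equivalence.from T-≡ (trans (sym (lookup∘tabulate _ x)) ([]=⇒lookup x∈)))

    sublevel-mono : ∀ {s t} → s ≤ t → sublevel r s ⊆ sublevel r t
    sublevel-mono s≤t x∈ = ∈sublevel⁺ (≤-trans (∈sublevel⁻ x∈) s≤t)

    sublevel-⊈ : ∀ {s t x} → s < r x → r x ≤ t → ¬ (sublevel r t ⊆ sublevel r s)
    sublevel-⊈ s<rx rx≤t ⊆ = <⇒≱ s<rx (∈sublevel⁻ (⊆ (∈sublevel⁺ rx≤t)))

    sublevel-strict : ∀ {B s t} → Attains r B → s < t → t ≤ B → ¬ (sublevel r t ⊆ sublevel r s)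
    sublevel-strict att s<t t≤B with att _ (≤-<-trans z≤n s<t) t≤B
    ... | x , refl = sublevel-⊈ s<t ≤-refl

record Arm {N : ℕ} (κ : Colouring N) (c : Fin 2) (k : ℕ) (x : Subset N) (a b : Fin N) : Set where
  field
    set    : Fin k → Subset N
    mono   : ∀ {i j} → i F.≤ j → set i ⊆ set j
    strict : ∀ {i j} → i F.< j → ¬ (set j ⊆ set i)
    above  : ∀ i → x ⊆ set i
    has    : ∀ i → a ∈ set i
    lacks  : ∀ i → b ∉ set i
    colour : ∀ i → κ (set i) ≡ c

VLe-antisym : ∀ {k} {p q : VElem k k} → VLe p q → VLe q p → p ≡ q
VLe-antisym x≤any   x≤any   = refl
VLe-antisym (y≤y p) (y≤y q) = cong vy (Fₚ.≤-antisym p q)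
VLe-antisym (z≤z p) (z≤z q) = cong vz (Fₚ.≤-antisym p q)

module _ {N : ℕ} {κ : Colouring N} {c : Fin 2} {k : ℕ} {x : Subset N} {a b : Fin N} where

  Arm-relabel : ∀ {a′ b′} (Y : Arm κ c k x a b) →
                (∀ i → a′ ∈ Arm.set Y i) → (∀ i → b′ ∉ Arm.set Y i) → Arm κ c k x a′ b′
  Arm-relabel Y has lacks = record { Arm Y; has = has; lacks = lacks }

  -- The two arms are separated by a and b, so neither can sit inside the other or below x.
  vCopy : κ x ≡ c → Arm κ c k x a b → Arm κ c k x b a → MonoCopy (V k k) N κ c
  vCopy κx Y Z = φ , injective , (λ p q → mk⇔ preserves reflects) , colour
    where
    module Y = Arm Y
    module Z = Arm Z

    φ : VElem k k → Subset N
    φ vx     = x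
    φ (vy i) = Y.set i
    φ (vz i) = Z.set i

    preserves : ∀ {p q} → VLe p q → φ p ⊆ φ q
    preserves {q = vx}   x≤any = λ x∈ → x∈
    preserves {q = vy i} x≤any = Y.above i
    preserves {q = vz i} x≤any = Z.above i
    preserves (y≤y i≤j) = Y.mono i≤j
    preserves (z≤z i≤j) = Z.mono i≤j

    reflects : ∀ {p q} → φ p ⊆ φ q → VLe p q
    reflects {vx} _ = x≤any
    reflects {vy i} {vx}   ⊆ = ⊥-elim (Z.lacks i (Z.above i (⊆ (Y.has i))))
    reflects {vy i} {vz j} ⊆ = ⊥-elim (Z.lacks j (⊆ (Y.has i)))
    reflects {vz i} {vx}   ⊆ = ⊥-elim (Y.lacks i (Y.above i (⊆ (Z.has i))))
    reflects {vz i} {vy j} ⊆ = ⊥-elim (Y.lacks j (⊆ (Z.has i)))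
    reflects {vy i} {vy j} ⊆ with i Fₚ.≤? j
    ... | yes i≤j = y≤y i≤j
    ... | no  i≰j = ⊥-elim (Y.strict (≰⇒> i≰j) ⊆)
    reflects {vz i} {vz j} ⊆ with i Fₚ.≤? j
    ... | yes i≤j = z≤z i≤j
    ... | no  i≰j = ⊥-elim (Z.strict (≰⇒> i≰j) ⊆)

    injective : ∀ {p q} → φ p ≡ φ q → p ≡ q
    injective φp≡φq =
      VLe-antisym (reflects (subst (_ ∈_) φp≡φq)) (reflects (subst (_ ∈_) (sym φp≡φq)))

    colour : ∀ p → κ (φ p) ≡ c
    colour vx     = κx
    colour (vy i) = Y.colour i
    colour (vz i) = Z.colour i

record Subseq (f : ℕ → Fin 2) (c : Fin 2) (lo len p : ℕ) : Set where
  field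
    index      : Fin p → ℕ
    lower      : ∀ i → lo ≤ index i
    upper      : ∀ i → index i < lo + len
    increasing : ∀ {i j} → i F.< j → index i < index j
    colour     : ∀ i → f (index i) ≡ c

  index-mono : ∀ {i j} → i F.≤ j → index i ≤ index j
  index-mono i≤j with m≤n⇒m<n∨m≡n i≤j
  ... | inj₁ i<j = <⇒≤ (increasing i<j)
  ... | inj₂ i≡j = ≤-reflexive (cong index (toℕ-injective i≡j))

module _ {f : ℕ → Fin 2} {c : Fin 2} where

  open Subseq

  empty : ∀ {lo len} → Subseq f c lo len 0
  empty = record { index = λ () ; lower = λ () ; upper = λ () ; increasing = λ {} ; colour = λ () }

  skip : ∀ {lo len p} → Subseq f c (suc lo) len p → Subseq f c lo (suc len) p
  skip {lo} {len} s = record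
    { index      = index s
    ; lower      = λ i → ≤-trans (n≤1+n lo) (lower s i)
    ; upper      = λ i → ≤-trans (upper s i) (≤-reflexive (sym (+-suc lo len)))
    ; increasing = increasing s
    ; colour     = colour s
    }

  cons : ∀ {lo len p} → f lo ≡ c → Subseq f c (suc lo) len p → Subseq f c lo (suc len) (suc p)
  cons {lo} {len} {p} flo s = record
    { index = index′ ; lower = lower′ ; upper = upper′ ; increasing = increasing′ ; colour = colour′ }
    where
    index′ : Fin (suc p) → ℕ
    index′ zero    = lo
    index′ (suc i) = index s i

    lower′ : ∀ i → lo ≤ index′ i
    lower′ zero    = ≤-refl
    lower′ (suc i) = <⇒≤ (lower s i)

    upper′ : ∀ i → index′ i < lo + suc len
    upper′ zero    = m<m+n lo z<s
    upper′ (suc i) = upper (skip s) i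

    increasing′ : ∀ {i j} → i F.< j → index′ i < index′ j
    increasing′ {zero}  {suc j} _         = lower s j
    increasing′ {suc i} {suc j} (s≤s i<j) = increasing s i<j

    colour′ : ∀ i → f (index′ i) ≡ c
    colour′ zero    = flo
    colour′ (suc i) = colour s i

  prependRun : ∀ k {len p} → (∀ t → t < k → f t ≡ c) →
               Subseq f c k len p → Subseq f c 0 (k + len) (k + p)
  prependRun zero    _   s = s
  prependRun (suc k) run s =
    subst₂ (Subseq f c 0) (+-suc k _) (+-suc k _)
      (prependRun k (λ t t<k → run t (m<n⇒m<1+n t<k)) (cons (run k ≤-refl) s))

pigeonhole : ∀ f lo p q → Subseq f red lo (p + q) (suc p) ⊎ Subseq f blue lo (p + q) q
pigeonhole f lo p zero = inj₂ empty
pigeonhole f lo p (suc q) with f lo in flo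
pigeonhole f lo zero    (suc q) | red = inj₁ (cons flo empty)
pigeonhole f lo (suc p) (suc q) | red = ⊎-map (cons flo) skip (pigeonhole f (suc lo) p (suc q))
pigeonhole f lo p       (suc q) | blue =
  subst (λ len → Subseq f red lo len (suc p) ⊎ Subseq f blue lo len (suc q)) (sym (+-suc p q))
    (⊎-map skip (cons flo) (pigeonhole f (suc lo) p q))

levelArm : ∀ {N} {κ : Colouring N} {c k lo len B} {x : Subset N} {a b} (r : Fin N → ℕ) →
           Attains r B → Subseq (κ ∘ sublevel r) c lo len k → lo + len ≤ suc B →
           x ⊆ sublevel r lo → r a ≤ lo → lo + len ≤ r b → Arm κ c k x a b
levelArm r att s bound x⊆ ra≤lo end≤rb = record
  { set    = sublevel r ∘ index
  ; mono   = λ i≤j → sublevel-mono r (index-mono i≤j)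
  ; strict = λ {_} {j} i<j → sublevel-strict r att (increasing i<j) (s≤s⁻¹ (≤-trans (upper j) bound))
  ; above  = λ i → sublevel-mono r (lower i) ∘ x⊆
  ; has    = λ i → ∈sublevel⁺ r (≤-trans ra≤lo (lower i))
  ; lacks  = λ i b∈ → <⇒≱ (<-≤-trans (upper i) end≤rb) (∈sublevel⁻ r b∈)
  ; colour = colour
  }
  where open Subseq s

bump : ℕ → ℕ → ℕ
bump k v with v ≤? k
... | yes _ = v
... | no  _ = suc v

bump-≤ : ∀ {k v} → v ≤ k → bump k v ≡ v
bump-≤ {k} {v} v≤k with v ≤? k
... | yes _   = refl
... | no  v≰k = ⊥-elim (v≰k v≤k)

bump-> : ∀ {k v} → k < v → bump k v ≡ suc v
bump-> {k} {v} k<v with v ≤? k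
... | yes v≤k = ⊥-elim (<⇒≱ k<v v≤k)
... | no  _   = refl

≤-bump : ∀ k v → v ≤ bump k v
≤-bump k v with v ≤? k
... | yes _ = ≤-refl
... | no  _ = n≤1+n v

module _ {N : ℕ} (r : Fin N → ℕ) (e : Fin N) (k : ℕ) where

  insertAfter : Fin N → ℕ
  insertAfter x with x Fₚ.≟ e
  ... | yes _ = suc k
  ... | no  _ = bump k (r x)

  insertAfter-self : insertAfter e ≡ suc k
  insertAfter-self with e Fₚ.≟ e
  ... | yes _   = refl
  ... | no  e≢e = ⊥-elim (e≢e refl)

  insertAfter-other : ∀ {x} → x ≢ e → insertAfter x ≡ bump k (r x)
  insertAfter-other {x} x≢e with x Fₚ.≟ e
  ... | yes x≡e = ⊥-elim (x≢e x≡e)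
  ... | no  _   = refl

  private
    ≢-by-rank : ∀ {B x} → B < r e → r x ≤ B → x ≢ e
    ≢-by-rank B<re rx≤B refl = <⇒≱ B<re rx≤B

  sublevel-insertAfter : ∀ {t} → k < r e → t ≤ k → sublevel insertAfter t ≡ sublevel r t
  sublevel-insertAfter {t} k<re t≤k = ⊆-antisym to from
    where
    to : sublevel insertAfter t ⊆ sublevel r t
    to {x} x∈ with x Fₚ.≟ e
    ... | yes refl =
      ⊥-elim (<⇒≱ (s≤s t≤k) (subst (_≤ t) insertAfter-self (∈sublevel⁻ insertAfter x∈)))
    ... | no  x≢e  = ∈sublevel⁺ r (≤-trans (≤-bump k (r x))
                       (subst (_≤ t) (insertAfter-other x≢e) (∈sublevel⁻ insertAfter x∈)))

    from : sublevel r t ⊆ sublevel insertAfter t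
    from {x} x∈ =
      ∈sublevel⁺ insertAfter (≤-trans (≤-reflexive (trans (insertAfter-other x≢e) (bump-≤ rx≤k))) rx≤t)
      where
      rx≤t : r x ≤ t
      rx≤t = ∈sublevel⁻ r x∈

      rx≤k : r x ≤ k
      rx≤k = ≤-trans rx≤t t≤k

      x≢e : x ≢ e
      x≢e = ≢-by-rank k<re rx≤k

  insertAfter-attains : ∀ {B} → k ≤ B → B < r e → Attains r B → Attains insertAfter (suc B)
  insertAfter-attains k≤B B<re att zero () _
  insertAfter-attains k≤B B<re att (suc t) _ t<1+B with suc t ≤? k | t ≟ k
  ... | yes t<k | _ = let x , rx≡1+t = att (suc t) z<s (≤-trans t<k k≤B) in
    x , (begin
      insertAfter x       ≡⟨ insertAfter-other (≢-by-rank B<re (≤-trans (≤-reflexive rx≡1+t) (≤-trans t<k k≤B))) ⟩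
      bump k (r x)        ≡⟨ cong (bump k) rx≡1+t ⟩
      bump k (suc t)      ≡⟨ bump-≤ t<k ⟩
      suc t               ∎)
    where open ≡-Reasoning
  ... | no _ | yes refl = e , insertAfter-self
  ... | no t≮k | no t≢k = let x , rx≡t = att t (≤-<-trans z≤n k<t) (s≤s⁻¹ t<1+B) in
    x , (begin
      insertAfter x       ≡⟨ insertAfter-other (≢-by-rank B<re (≤-trans (≤-reflexive rx≡t) (s≤s⁻¹ t<1+B))) ⟩
      bump k (r x)        ≡⟨ cong (bump k) rx≡t ⟩
      bump k t            ≡⟨ bump-> k<t ⟩
      suc t               ∎)
    where
    open ≡-Reasoning

    k<t : k < t
    k<t = ≤∧≢⇒< (s≤s⁻¹ (≰⇒> t≮k)) (t≢k ∘ sym)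

firstBlue : (f : ℕ → Fin 2) (b : ℕ) →
            (∀ t → t < b → f t ≡ red) ⊎
            ∃ λ k → k < b × (∀ t → t < k → f t ≡ red) × f k ≡ blue
firstBlue f zero = inj₁ (λ _ ())
firstBlue f (suc b) with firstBlue f b
... | inj₂ (k , k<b , reds , fk≡blue) = inj₂ (k , m<n⇒m<1+n k<b , reds , fk≡blue)
... | inj₁ reds with f b in fb
...   | red  = inj₁ λ t t<1+b → [ reds t , (λ { refl → fb }) ]′ (m≤n⇒m<n∨m≡n (s≤s⁻¹ t<1+b))
...   | blue = inj₂ (b , ≤-refl , reds , fb)

module Dichotomy {N : ℕ} (m′ n′ B : ℕ) (m′+n′≡B : m′ + n′ ≡ B)
                 (κ : Colouring N) (κ∅ : κ ∅ ≡ red) where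

  m n : ℕ
  m = suc m′
  n = suc n′

  PointsTo : Fin N → Fin N → Set
  PointsTo a b = Arm κ red m ∅ a b

  RedCopy BlueCopy : Set
  RedCopy  = MonoCopy (V m m) N κ red
  BlueCopy = MonoCopy (V n n) N κ blue

  Reaches : Fin N → Fin N → Set
  Reaches a b = BlueCopy ⊎ PointsTo a b

  copyFromTwoCycle : ∀ {a b} → Reaches a b → Reaches b a → RedCopy ⊎ BlueCopy
  copyFromTwoCycle (inj₁ blueCopy) _                = inj₂ blueCopy
  copyFromTwoCycle (inj₂ _)        (inj₁ blueCopy)  = inj₂ blueCopy
  copyFromTwoCycle (inj₂ ab)       (inj₂ ba)        = inj₁ (vCopy κ∅ ab ba)

  module _ (r : Fin N → ℕ) {α β γ : Fin N} (att : Attains r B)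
           (rα≡0 : r α ≡ 0) (B<rβ : B < r β) (B<rγ : B < r γ) (β≢γ : β ≢ γ) where

    private
      L : ℕ → Subset N
      L = sublevel r

      ∅⊆ : ∀ {S : Subset N} → ∅ ⊆ S
      ∅⊆ = ⊥-elim ∘ ∉⊥

      m≤1+B : m ≤ suc B
      m≤1+B = s≤s (≤-trans (m≤m+n m′ n′) (≤-reflexive m′+n′≡B))

    allRed : (∀ t → t < m → κ (L t) ≡ red) → PointsTo α β
    allRed reds = levelArm r att run m≤1+B ∅⊆ (≤-reflexive rα≡0) (≤-trans m≤1+B B<rβ)
      where
      run : Subseq (κ ∘ L) red 0 m m
      run = subst₂ (Subseq _ red 0) (+-identityʳ m) (+-identityʳ m) (prependRun m reds empty)

    module FirstBlue (k : ℕ) (k<m : k < m) (reds : ∀ t → t < k → κ (L t) ≡ red) where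

      private
        k≤B : k ≤ B
        k≤B = s≤s⁻¹ (≤-trans k<m m≤1+B)

        rest : ℕ
        rest = proj₁ (m≤n⇒∃[o]m+o≡n (s≤s⁻¹ k<m))

        k+rest≡m′ : k + rest ≡ m′
        k+rest≡m′ = proj₂ (m≤n⇒∃[o]m+o≡n (s≤s⁻¹ k<m))

        top : k + (rest + n) ≡ suc B
        top = begin
          k + (rest + suc n′)  ≡⟨ +-assoc k rest (suc n′) ⟨
          k + rest + suc n′    ≡⟨ cong (_+ suc n′) k+rest≡m′ ⟩
          m′ + suc n′          ≡⟨ +-suc m′ n′ ⟩
          suc (m′ + n′)        ≡⟨ cong suc m′+n′≡B ⟩
          suc B                ∎
          where open ≡-Reasoning

      module _ {e o : Fin N} (B<re : B < r e) (B<ro : B < r o) (e≢o : e ≢ o) where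

        private
          r′ : Fin N → ℕ
          r′ = insertAfter r e k

          att′ : Attains r′ (suc B)
          att′ = insertAfter-attains r e k k≤B B<re att

          lowLevels : ∀ {t} → t ≤ k → sublevel r′ t ≡ L t
          lowLevels = sublevel-insertAfter r e k (≤-<-trans k≤B B<re)

          r′α≡0 : r′ α ≡ 0
          r′α≡0 = trans (insertAfter-other r e k α≢e) (trans (cong (bump k) rα≡0) (bump-≤ {k} z≤n))
            where
            α≢e : α ≢ e
            α≢e refl = <⇒≢ (≤-<-trans z≤n B<re) (sym rα≡0)

          2+B≤r′o : suc (suc B) ≤ r′ o
          2+B≤r′o = ≤-trans (s≤s B<ro) (≤-reflexive (sym r′o≡1+ro))
            where
            r′o≡1+ro : r′ o ≡ suc (r o)
            r′o≡1+ro = trans (insertAfter-other r e k (e≢o ∘ sym)) (bump-> (≤-<-trans k≤B B<ro))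

        redOrBlueArm : PointsTo α o ⊎ Arm κ blue n (L k) e o
        redOrBlueArm with pigeonhole (κ ∘ sublevel r′) (suc k) rest n
        ... | inj₁ laterReds =
          inj₁ (levelArm r′ att′ run (≤-reflexive length) ∅⊆ (≤-reflexive r′α≡0)
                  (≤-trans (≤-reflexive length) 2+B≤r′o))
          where
          length : k + suc (rest + n) ≡ suc (suc B)
          length = trans (+-suc k (rest + n)) (cong suc top)

          run : Subseq (κ ∘ sublevel r′) red 0 (k + suc (rest + n)) m
          run = subst (Subseq _ red 0 _) (trans (+-suc k rest) (cong suc k+rest≡m′))
                  (prependRun k (λ t t<k → trans (cong κ (lowLevels (<⇒≤ t<k))) (reds t t<k))
                     (skip laterReds))
        ... | inj₂ blues =
          inj₂ (levelArm r′ att′ blues (≤-reflexive (cong suc top)) Lk⊆ (≤-reflexive (insertAfter-self r e k))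
                  (≤-trans (≤-reflexive (cong suc top)) 2+B≤r′o))
          where
          Lk⊆ : L k ⊆ sublevel r′ (suc k)
          Lk⊆ = sublevel-mono r′ (n≤1+n k) ∘ subst (_ ∈_) (sym (lowLevels ≤-refl))

    dichotomy : Reaches α β ⊎ Reaches α γ
    dichotomy with firstBlue (κ ∘ L) m
    ... | inj₁ reds = inj₁ (inj₂ (allRed reds))
    ... | inj₂ (k , k<m , reds , Lk≡blue)
          with FirstBlue.redOrBlueArm k k<m reds B<rγ B<rβ (β≢γ ∘ sym)
             | FirstBlue.redOrBlueArm k k<m reds B<rβ B<rγ β≢γ
    ...   | inj₁ αβ | _       = inj₁ (inj₂ αβ)
    ...   | _       | inj₁ αγ = inj₂ (inj₂ αγ)
    ...   | inj₂ γβ | inj₂ βγ = inj₁ (inj₁ (vCopy Lk≡blue γβ βγ))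

module _ {A : Set} (R : A → A → Set) where

  TwoCycle : Set
  TwoCycle = ∃ λ a → ∃ λ b → R a b × R b a

  Triangle : Set
  Triangle = ∃ λ a → ∃ λ b → ∃ λ c → R a b × R b c × R c a

  module _ (outward : ∀ {a b c d} → a ≢ b → a ≢ c → a ≢ d → b ≢ c → b ≢ d → c ≢ d →
                      R a b ⊎ R a c) where

    twoCycle-from : ∀ {p q r s} → p ≢ q → p ≢ r → p ≢ s → q ≢ r → q ≢ s → r ≢ s →
                    R p q → TwoCycle
    twoCycle-from {p} {q} {r} {s} p≢q p≢r p≢s q≢r q≢s r≢s Rpq
      with outward (≢-sym p≢q) q≢r q≢s p≢r p≢s r≢s
    ... | inj₁ Rqp = p , q , Rpq , Rqp
    ... | inj₂ Rqr with outward (≢-sym p≢q) q≢s q≢r p≢s p≢r (≢-sym r≢s)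
    ...   | inj₁ Rqp = p , q , Rpq , Rqp
    ...   | inj₂ Rqs with outward (≢-sym q≢r) r≢s (≢-sym p≢r) q≢s (≢-sym p≢q) (≢-sym p≢s)
    ...     | inj₁ Rrq = q , r , Rqr , Rrq
    ...     | inj₂ Rrs with outward (≢-sym q≢s) (≢-sym r≢s) (≢-sym p≢s) q≢r (≢-sym p≢q) (≢-sym p≢r)
    ...       | inj₁ Rsq = q , s , Rqs , Rsq
    ...       | inj₂ Rsr = r , s , Rrs , Rsr

twoCycle-fin4 : (R : Fin 4 → Fin 4 → Set) →
                (∀ {a b c d} → a ≢ b → a ≢ c → a ≢ d → b ≢ c → b ≢ d → c ≢ d → R a b ⊎ R a c) →
                TwoCycle R
twoCycle-fin4 R outward with outward {# 0} {# 1} {# 2} {# 3} (λ ()) (λ ()) (λ ()) (λ ()) (λ ()) (λ ())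
... | inj₁ R01 = twoCycle-from R outward {# 0} {# 1} {# 2} {# 3} (λ ()) (λ ()) (λ ()) (λ ()) (λ ()) (λ ()) R01
... | inj₂ R02 = twoCycle-from R outward {# 0} {# 2} {# 1} {# 3} (λ ()) (λ ()) (λ ()) (λ ()) (λ ()) (λ ()) R02

twoCycleOrTriangle-fin3 : (R : Fin 3 → Fin 3 → Set) →
                          (∀ {a b c} → a ≢ b → a ≢ c → b ≢ c → R a b ⊎ R a c) →
                          TwoCycle R ⊎ Triangle R
twoCycleOrTriangle-fin3 R outward with outward {# 0} {# 1} {# 2} (λ ()) (λ ()) (λ ())
... | inj₁ R01 with outward {# 1} {# 0} {# 2} (λ ()) (λ ()) (λ ())
...   | inj₁ R10 = inj₁ (# 0 , # 1 , R01 , R10)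
...   | inj₂ R12 with outward {# 2} {# 1} {# 0} (λ ()) (λ ()) (λ ())
...     | inj₁ R21 = inj₁ (# 1 , # 2 , R12 , R21)
...     | inj₂ R20 = inj₂ (# 0 , # 1 , # 2 , R01 , R12 , R20)
twoCycleOrTriangle-fin3 R outward | inj₂ R02 with outward {# 2} {# 0} {# 1} (λ ()) (λ ()) (λ ())
...   | inj₁ R20 = inj₁ (# 0 , # 2 , R02 , R20)
...   | inj₂ R21 with outward {# 1} {# 2} {# 0} (λ ()) (λ ()) (λ ())
...     | inj₁ R12 = inj₁ (# 1 , # 2 , R12 , R21)
...     | inj₂ R10 = inj₂ (# 0 , # 2 , # 1 , R02 , R21 , R10)

triangleCopy : ∀ {N} {κ : Colouring N} {a b c} → κ ∅ ≡ red →
               Arm κ red 1 ∅ a b → Arm κ red 1 ∅ b c → Arm κ red 1 ∅ c a → MonoCopy (V 1 1) N κ red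
triangleCopy {c = c} κ∅ X Y Z with c ∈? Arm.set X zero
... | no  c∉X = vCopy κ∅ (Arm-relabel X (Arm.has X) (λ { zero → c∉X })) Z
... | yes c∈X = vCopy κ∅ (Arm-relabel X (λ { zero → c∈X }) (Arm.lacks X)) Y

specialRank : ∀ {s} → ℕ → Fin s → Fin s → Fin s → ℕ
specialRank top a d x with x Fₚ.≟ a | x Fₚ.≟ d
... | yes _ | _     = 0
... | no  _ | yes _ = 1
... | no  _ | no  _ = top

module _ {s} (top : ℕ) (a d : Fin s) where

  specialRank-first : specialRank top a d a ≡ 0
  specialRank-first with a Fₚ.≟ a
  ... | yes _   = refl
  ... | no  a≢a = ⊥-elim (a≢a refl)

  specialRank-second : d ≢ a → specialRank top a d d ≡ 1
  specialRank-second d≢a with d Fₚ.≟ a | d Fₚ.≟ d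
  ... | yes d≡a | _       = ⊥-elim (d≢a d≡a)
  ... | no  _   | yes _   = refl
  ... | no  _   | no  d≢d = ⊥-elim (d≢d refl)

  specialRank-rest : ∀ {x} → x ≢ a → x ≢ d → specialRank top a d x ≡ top
  specialRank-rest {x} x≢a x≢d with x Fₚ.≟ a | x Fₚ.≟ d
  ... | yes x≡a | _       = ⊥-elim (x≢a x≡a)
  ... | no  _   | yes x≡d = ⊥-elim (x≢d x≡d)
  ... | no  _   | no  _   = refl

fourPointRank : ∀ {B} → Fin 4 → Fin 4 → Fin (4 + B) → ℕ
fourPointRank {B} a d = [ specialRank (suc (suc B)) a d , (2 +_) ∘ toℕ ]′ ∘ splitAt 4

module _ {B : ℕ} {a d : Fin 4} where

  fourPointRank-special : ∀ x → fourPointRank a d (x ↑ˡ B) ≡ specialRank (suc (suc B)) a d x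
  fourPointRank-special x = cong [ specialRank (suc (suc B)) a d , (2 +_) ∘ toℕ ]′ (splitAt-↑ˡ 4 x B)

  fourPointRank-rest : ∀ j → fourPointRank a d (4 ↑ʳ j) ≡ 2 + toℕ j
  fourPointRank-rest j = cong [ specialRank (suc (suc B)) a d , (2 +_) ∘ toℕ ]′ (splitAt-↑ʳ 4 B j)

  fourPointRank-attains : d ≢ a → Attains (fourPointRank {B} a d) (suc B)
  fourPointRank-attains d≢a zero () _
  fourPointRank-attains d≢a 1 _ _ = d ↑ˡ B , trans (fourPointRank-special d) (specialRank-second _ a d d≢a)
  fourPointRank-attains d≢a (suc (suc t)) _ 2+t≤1+B =
    4 ↑ʳ fromℕ< t<B , trans (fourPointRank-rest (fromℕ< t<B)) (cong (2 +_) (toℕ-fromℕ< t<B))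
    where
    t<B : t < B
    t<B = s≤s⁻¹ 2+t≤1+B

redOrBlueCopy-N≡3 : (κ : Colouring 3) → κ ∅ ≡ red →
                    MonoCopy (V 1 1) 3 κ red ⊎ MonoCopy (V 1 1) 3 κ blue
redOrBlueCopy-N≡3 κ κ∅ with twoCycleOrTriangle-fin3 Reaches outward
  where
  open Dichotomy 0 0 0 refl κ κ∅

  -- With d = a no point gets rank 1, and none has to, as the ranks need only reach 0.
  outward : ∀ {a b c} → a ≢ b → a ≢ c → b ≢ c → Reaches a b ⊎ Reaches a c
  outward {a} a≢b a≢c b≢c =
    dichotomy (specialRank 1 a a) (λ _ 0<t t≤0 → ⊥-elim (<⇒≱ 0<t t≤0)) (specialRank-first 1 a a)
      (≤-reflexive (sym (specialRank-rest 1 a a (≢-sym a≢b) (≢-sym a≢b))))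
      (≤-reflexive (sym (specialRank-rest 1 a a (≢-sym a≢c) (≢-sym a≢c)))) b≢c
... | inj₁ (_ , _ , ab , ba) = Dichotomy.copyFromTwoCycle 0 0 0 refl κ κ∅ ab ba
... | inj₂ (_ , _ , _ , inj₁ blueCopy , _ , _) = inj₂ blueCopy
... | inj₂ (_ , _ , _ , _ , inj₁ blueCopy , _) = inj₂ blueCopy
... | inj₂ (_ , _ , _ , _ , _ , inj₁ blueCopy) = inj₂ blueCopy
... | inj₂ (_ , _ , _ , inj₂ ab , inj₂ bc , inj₂ ca) = inj₁ (triangleCopy κ∅ ab bc ca)

redOrBlueCopy-N≥4 : ∀ m′ n′ B → m′ + n′ ≡ suc B → (κ : Colouring (4 + B)) → κ ∅ ≡ red →
                    MonoCopy (V (suc m′) (suc m′)) (4 + B) κ red ⊎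
                    MonoCopy (V (suc n′) (suc n′)) (4 + B) κ blue
redOrBlueCopy-N≥4 m′ n′ B m′+n′≡1+B κ κ∅ =
  let _ , _ , ab , ba = twoCycle-fin4 (λ a b → Reaches (a ↑ˡ B) (b ↑ˡ B)) outward in copyFromTwoCycle ab ba
  where
  open Dichotomy m′ n′ (suc B) m′+n′≡1+B κ κ∅

  outward : ∀ {a b c d} → a ≢ b → a ≢ c → a ≢ d → b ≢ c → b ≢ d → c ≢ d →
            Reaches (a ↑ˡ B) (b ↑ˡ B) ⊎ Reaches (a ↑ˡ B) (c ↑ˡ B)
  outward {a} {b} {c} {d} a≢b a≢c a≢d b≢c b≢d c≢d =
    dichotomy (fourPointRank a d) (fourPointRank-attains (≢-sym a≢d))
      (trans (fourPointRank-special a) (specialRank-first _ a d))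
      (≤-reflexive (sym (trans (fourPointRank-special b) (specialRank-rest _ a d (≢-sym a≢b) b≢d))))
      (≤-reflexive (sym (trans (fourPointRank-special c) (specialRank-rest _ a d (≢-sym a≢c) c≢d))))
      (b≢c ∘ ↑ˡ-injective B b c)

redOrBlueCopy : ∀ m′ n′ B → m′ + n′ ≡ B → (κ : Colouring (3 + B)) → κ ∅ ≡ red →
                MonoCopy (V (suc m′) (suc m′)) (3 + B) κ red ⊎
                MonoCopy (V (suc n′) (suc n′)) (3 + B) κ blue
redOrBlueCopy zero    zero    zero    refl   = redOrBlueCopy-N≡3
redOrBlueCopy (suc _) _       zero    ()
redOrBlueCopy zero    (suc _) zero    ()
redOrBlueCopy m′      n′      (suc B) m′+n′≡1+B = redOrBlueCopy-N≥4 m′ n′ B m′+n′≡1+B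

invert : Fin 2 → Fin 2
invert red  = blue
invert blue = red

invert-involutive : ∀ c → invert (invert c) ≡ c
invert-involutive red  = refl
invert-involutive blue = refl

MonoCopy-invert : ∀ {P N κ c} → MonoCopy P N (invert ∘ κ) c → MonoCopy P N κ (invert c)
MonoCopy-invert {κ = κ} (φ , injective , embeds , colour) =
  φ , injective , embeds , λ p → trans (sym (invert-involutive (κ (φ p)))) (cong invert (colour p))

upperBound : ∀ m n → 1 ≤ m → 1 ≤ n → RamseyProp (V m m) (V n n) (m + n + 1)
upperBound (suc m′) (suc n′) _ _ = subst (RamseyProp _ _) (sym (size m′ n′)) ramsey
  where
  size : ∀ m′ n′ → suc m′ + suc n′ + 1 ≡ 3 + (m′ + n′)
  size = solve-∀

  ramsey : RamseyProp (V (suc m′) (suc m′)) (V (suc n′) (suc n′)) (3 + (m′ + n′))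
  ramsey κ with κ ∅ in κ∅
  ... | red  = redOrBlueCopy m′ n′ _ refl κ κ∅
  ... | blue = [ inj₂ ∘ MonoCopy-invert {κ = κ} , inj₁ ∘ MonoCopy-invert {κ = κ} ]′
                 (redOrBlueCopy n′ m′ _ (+-comm n′ m′) (invert ∘ κ) (cong invert κ∅))

p⊆q∧q⊈p⇒∣p∣<∣q∣ : ∀ {N} {p q : Subset N} → p ⊆ q → ¬ (q ⊆ p) → ∣ p ∣ < ∣ q ∣
p⊆q∧q⊈p⇒∣p∣<∣q∣ {N} {p} {q} p⊆q q⊈p
  with ¬∀⟶∃¬ N (λ x → x ∈ q → x ∈ p) (λ x → x ∈? q →-dec x ∈? p) (λ q⊆p → q⊈p (q⊆p _))
... | x , ¬q→p = p⊂q⇒∣p∣<∣q∣ (p⊆q , x , x∈q , λ x∈p → ¬q→p (λ _ → x∈p))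
  where
  x∈q : x ∈ q
  x∈q = decidable-stable (x ∈? q) (λ x∉q → ¬q→p (⊥-elim ∘ x∉q))

increasing⇒spread : ∀ {k} (f : Fin (suc k) → ℕ) → (∀ i → f (inject₁ i) < f (suc i)) →
                    f zero + k ≤ f (fromℕ k)
increasing⇒spread {zero}  f _    = ≤-reflexive (+-identityʳ (f zero))
increasing⇒spread {suc k} f step = begin
  f zero + suc k       ≡⟨ +-suc (f zero) k ⟩
  suc (f zero) + k     ≤⟨ +-monoˡ-≤ k (step zero) ⟩
  f (suc zero) + k     ≤⟨ increasing⇒spread (f ∘ suc) (step ∘ suc) ⟩
  f (fromℕ (suc k))    ∎
  where open ≤-Reasoning

module _ {N k} {φ : VElem (suc k) (suc k) → Subset N} (embeds : ∀ p q → VLe p q ⇔ (φ p ⊆ φ q)) where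

  armTop-size : (arm : Fin (suc k) → VElem (suc k) (suc k)) →
                (∀ {i j} → i F.≤ j → VLe (arm i) (arm j)) → (∀ {i j} → VLe (arm i) (arm j) → i F.≤ j) →
                (∀ i → ¬ VLe (arm i) vx) → ∣ φ vx ∣ + suc k ≤ ∣ φ (arm (fromℕ k)) ∣
  armTop-size arm arm-mono arm-reflects arm≰vx = increasing⇒spread (∣_∣ ∘ φ ∘ ray) step
    where
    ray : Fin (suc (suc k)) → VElem (suc k) (suc k)
    ray zero    = vx
    ray (suc i) = arm i

    size< : ∀ {p q} → VLe p q → ¬ VLe q p → ∣ φ p ∣ < ∣ φ q ∣
    size< p≤q q≰p =
      p⊆q∧q⊈p⇒∣p∣<∣q∣ (Equivalence.to (embeds _ _) p≤q) (q≰p ∘ Equivalence.from (embeds _ _))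

    step : ∀ i → ∣ φ (ray (inject₁ i)) ∣ < ∣ φ (ray (suc i)) ∣
    step zero    = size< x≤any (arm≰vx zero)
    step (suc i) = size< (arm-mono (<⇒≤ i<1+i)) (<⇒≱ i<1+i ∘ arm-reflects)
      where
      i<1+i : inject₁ i F.< suc i
      i<1+i = ≤̄⇒inject₁< ≤-refl

  vyTop-size : ∣ φ vx ∣ + suc k ≤ ∣ φ (vy (fromℕ k)) ∣
  vyTop-size = armTop-size vy y≤y (λ { (y≤y i≤j) → i≤j }) (λ _ ())

  vzTop-size : ∣ φ vx ∣ + suc k ≤ ∣ φ (vz (fromℕ k)) ∣
  vzTop-size = armTop-size vz z≤z (λ { (z≤z i≤j) → i≤j }) (λ _ ())

bySize : ∀ {N} → ℕ → Colouring N
bySize n S with n ≤? ∣ S ∣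
... | yes _ = red
... | no  _ = blue

module _ {N n : ℕ} {S : Subset N} where

  bySize-red : bySize n S ≡ red → n ≤ ∣ S ∣
  bySize-red _ with n ≤? ∣ S ∣
  ... | yes n≤∣S∣ = n≤∣S∣

  bySize-blue : bySize n S ≡ blue → ∣ S ∣ < n
  bySize-blue _ with n ≤? ∣ S ∣
  ... | no n≰∣S∣ = ≰⇒> n≰∣S∣

lowerBound : ∀ m n N → 1 ≤ m → 1 ≤ n → N < m + n + 1 → ¬ RamseyProp (V m m) (V n n) N
lowerBound (suc m′) n N _ (s≤s _) N<m+n+1 ramsey with ramsey (bySize n)
... | inj₁ (φ , injective , embeds , colour) =
  vy≢vz (injective (trans (full (vyTop-size embeds)) (sym (full (vzTop-size embeds)))))
  where
  full : ∀ {S} → ∣ φ vx ∣ + suc m′ ≤ ∣ S ∣ → S ≡ ⊤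
  full {S} big = ∣p∣≡n⇒p≡⊤ (≤-antisym (∣p∣≤n S) (begin
    N                    ≤⟨ s≤s⁻¹ (≤-trans N<m+n+1 (≤-reflexive (+-comm _ 1))) ⟩
    suc m′ + n           ≡⟨ +-comm (suc m′) n ⟩
    n + suc m′           ≤⟨ +-monoˡ-≤ (suc m′) (bySize-red (colour vx)) ⟩
    ∣ φ vx ∣ + suc m′    ≤⟨ big ⟩
    ∣ S ∣                ∎))
    where open ≤-Reasoning

  vy≢vz : vy (fromℕ m′) ≢ vz (fromℕ m′)
  vy≢vz ()
... | inj₂ (φ , _ , embeds , colour) =
  <⇒≱ (bySize-blue (colour (vy (fromℕ _)))) (≤-trans (m≤n+m n ∣ φ vx ∣) (vyTop-size embeds))

theorem2 : ∀ (m n : ℕ) → 1 ≤ m → 1 ≤ n → RamseyNumberIs (V m m) (V n n) (m + n + 1)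
theorem2 m n 1≤m 1≤n = upperBound m n 1≤m 1≤n , λ N N<m+n+1 → lowerBound m n N 1≤m 1≤n N<m+n+1
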